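{- Let $\mathbb{K}\in\{\mathbb{R},\mathbb{C}\}$ and $A_1,\ldots,A_k\in M_n(\mathbb{K})$, with $A_1$ and $A_k$ nonsingular. The $k-1$ matrices $A_k^{ -1}A_i$ ($i=1,\ldots,k-1$) pairwise commute if and only if the $k-1$ matrices $A_1^{ -1}A_i$ ($i=2,\ldots,k$) pairwise commute. -}

module Defs where

open import Level using (Level; _⊔_)
open import Data.Nat using (ℕ; zero; suc)
open import Data.Fin using (Fin; zero; suc)
open import Data.Product using (Σ; _×_)
open import Algebra.Bundles using (CommutativeRing)

module Matrices {c ℓ : Level} (R : CommutativeRing c ℓ) where
  open CommutativeRing R using (Carrier; _≈_; _+_; _*_; 0#; 1#)

  Mat : ℕ → Set c
  Mat n = Fin n → Fin n → Carrier

  ∑ : {n : ℕ} → (Fin n → Carrier) → Carrier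
  ∑ {zero}  f = 0#
  ∑ {suc n} f = f zero + ∑ (λ j → f (suc j))

  infixl 7 _⊗_
  infix 4 _≋_
  _⊗_ : {n : ℕ} → Mat n → Mat n → Mat n
  (A ⊗ B) i j = ∑ (λ l → A i l * B l j)

  I : {n : ℕ} → Mat n
  I zero    zero    = 1#
  I zero    (suc _) = 0#
  I (suc _) zero    = 0#
  I (suc i) (suc j) = I i j

  _≋_ : {n : ℕ} → Mat n → Mat n → Set ℓ
  A ≋ B = ∀ i j → A i j ≈ B i j

  IsInverse : {n : ℕ} → Mat n → Mat n → Set ℓ
  IsInverse A B = (A ⊗ B ≋ I) × (B ⊗ A ≋ I)

  Nonsingular : {n : ℕ} → Mat n → Set (c ⊔ ℓ)
  Nonsingular {n} A = Σ (Mat n) (IsInverse A)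

  Commute : {n : ℕ} → Mat n → Mat n → Set ℓ
  Commute A B = A ⊗ B ≋ B ⊗ A

module Submission where

-- Put X_t = A_k⁻¹ A_t and Z_t = A_1⁻¹ A_t for every t, including t = 1 and t = k.
-- Since X_k = I and Z_1 = I, each side says that the whole family X (resp. Z)
-- pairwise commutes. Now Z_t = Y X_t with Y = A_1⁻¹ A_k, which is inverse to X_1;
-- an inverse of a member of a commuting family commutes with the whole family,
-- so the Y X_t commute pairwise as well. The converse is symmetric.

open import Defs
open import Level using (Level; _⊔_)
open import Data.Nat using (ℕ; zero; suc)
open import Data.Fin using (Fin; zero; suc; fromℕ; inject₁)
open import Data.Fin.Relation.Unary.Top using (view; ‵fromℕ; ‵inject₁)
open import Data.Product using (_×_; _,_; proj₁)
open import Function.Base using (_∘_)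
open import Function.Bundles using (_⇔_; mk⇔)
open import Relation.Binary.PropositionalEquality using (_≡_; cong) renaming (refl to ≡-refl)
open import Algebra.Bundles using (Monoid; CommutativeRing)
import Algebra.Properties.Monoid as MonoidProperties
import Algebra.Properties.Semiring.Sum as SemiringSum
import Relation.Binary.Reasoning.Setoid as SetoidReasoning

module CommutingFamilies {a ℓ : Level} (M : Monoid a ℓ) where
  open Monoid M
  open MonoidProperties M
  open SetoidReasoning setoid

  Commutes : Carrier → Carrier → Set ℓ
  Commutes x y = x ∙ y ≈ y ∙ x

  PairwiseCommuting : {i : Level} {I : Set i} → (I → Carrier) → Set (i ⊔ ℓ)
  PairwiseCommuting x = ∀ s t → Commutes (x s) (x t)

  IsInverse : Carrier → Carrier → Set ℓ
  IsInverse x y = (x ∙ y ≈ ε) × (y ∙ x ≈ ε)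

  ≈ε⇒commutes : ∀ {u} → u ≈ ε → ∀ x → Commutes u x
  ≈ε⇒commutes u≈ε x = trans (elimˡ u≈ε x) (introʳ u≈ε x)

  commutes-sym : ∀ {x y} → Commutes x y → Commutes y x
  commutes-sym = sym

  commutes-resp-≈ : ∀ {x x′ y y′} → x ≈ x′ → y ≈ y′ → Commutes x y → Commutes x′ y′
  commutes-resp-≈ x≈x′ y≈y′ xy≈yx =
    trans (∙-cong (sym x≈x′) (sym y≈y′)) (trans xy≈yx (∙-cong y≈y′ x≈x′))

  ∙-commutesˡ : ∀ {x y z} → Commutes x z → Commutes y z → Commutes (x ∙ y) z
  ∙-commutesˡ {x} {y} {z} xz≈zx yz≈zy = begin
    (x ∙ y) ∙ z  ≈⟨ assoc x y z ⟩
    x ∙ (y ∙ z)  ≈⟨ ∙-congˡ yz≈zy ⟩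
    x ∙ (z ∙ y)  ≈⟨ assoc x z y ⟨
    (x ∙ z) ∙ y  ≈⟨ ∙-congʳ xz≈zx ⟩
    (z ∙ x) ∙ y  ≈⟨ assoc z x y ⟩
    z ∙ (x ∙ y)  ∎

  ∙-commutesʳ : ∀ {x y z} → Commutes x y → Commutes x z → Commutes x (y ∙ z)
  ∙-commutesʳ xy≈yx xz≈zx =
    commutes-sym (∙-commutesˡ (commutes-sym xy≈yx) (commutes-sym xz≈zx))

  pairwiseCommuting-resp-≈ : ∀ {i} {I : Set i} {x y : I → Carrier} →
    (∀ t → x t ≈ y t) → PairwiseCommuting x → PairwiseCommuting y
  pairwiseCommuting-resp-≈ x≈y comm s t = commutes-resp-≈ (x≈y s) (x≈y t) (comm s t)

  pairwiseCommuting-suc⁺ : ∀ {m} {x : Fin (suc m) → Carrier} →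
    x zero ≈ ε → PairwiseCommuting (x ∘ suc) → PairwiseCommuting x
  pairwiseCommuting-suc⁺ x₀≈ε comm zero    t       = ≈ε⇒commutes x₀≈ε _
  pairwiseCommuting-suc⁺ x₀≈ε comm (suc s) zero    = commutes-sym (≈ε⇒commutes x₀≈ε _)
  pairwiseCommuting-suc⁺ x₀≈ε comm (suc s) (suc t) = comm s t

  pairwiseCommuting-inject₁⁺ : ∀ {m} {x : Fin (suc m) → Carrier} →
    x (fromℕ m) ≈ ε → PairwiseCommuting (x ∘ inject₁) → PairwiseCommuting x
  pairwiseCommuting-inject₁⁺ xₘ≈ε comm s t with view s | view t
  ... | ‵fromℕ      | _           = ≈ε⇒commutes xₘ≈ε _
  ... | ‵inject₁ s′ | ‵fromℕ      = commutes-sym (≈ε⇒commutes xₘ≈ε _)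
  ... | ‵inject₁ s′ | ‵inject₁ t′ = comm s′ t′

  inverse-commutes : ∀ {i} {I : Set i} {x : I → Carrier} {r y} →
    PairwiseCommuting x → IsInverse (x r) y → ∀ t → Commutes y (x t)
  inverse-commutes {x = x} {r} {y} comm (xᵣy≈ε , yxᵣ≈ε) t = begin
    y ∙ x t                    ≈⟨ introʳ xᵣy≈ε (y ∙ x t) ⟩
    (y ∙ x t) ∙ (x r ∙ y)      ≈⟨ uv∙wx≈u[vw∙x] y (x t) (x r) y ⟩
    y ∙ ((x t ∙ x r) ∙ y)      ≈⟨ ∙-congˡ (∙-congʳ (comm t r)) ⟩
    y ∙ ((x r ∙ x t) ∙ y)      ≈⟨ uv∙wx≈u[vw∙x] y (x r) (x t) y ⟨
    (y ∙ x r) ∙ (x t ∙ y)      ≈⟨ elimˡ yxᵣ≈ε (x t ∙ y) ⟩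
    x t ∙ y                    ∎

  pairwiseCommuting-translate : ∀ {i} {I : Set i} {x : I → Carrier} {r y} →
    PairwiseCommuting x → IsInverse (x r) y → PairwiseCommuting (λ t → y ∙ x t)
  pairwiseCommuting-translate comm inv s t =
    ∙-commutesˡ (∙-commutesʳ refl (yx≈xy t)) (∙-commutesʳ (commutes-sym (yx≈xy s)) (comm s t))
    where yx≈xy = inverse-commutes comm inv

  -- P a_t = (P a_q)(Q a_t), and P a_q is inverse to Q a_p.
  pairwiseCommuting-rebase : ∀ {i} {I : Set i} (x : I → Carrier) {p q P Q} →
    IsInverse (x p) P → IsInverse (x q) Q →
    PairwiseCommuting (λ t → Q ∙ x t) → PairwiseCommuting (λ t → P ∙ x t)
  pairwiseCommuting-rebase x {p} {q} {P} {Q} (xpP≈ε , Pxp≈ε) (xqQ≈ε , Qxq≈ε) comm =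
    pairwiseCommuting-resp-≈ (λ t → cancelᶜ xqQ≈ε P (x t))
      (pairwiseCommuting-translate comm
        ( trans (cancelᶜ xpP≈ε Q (x q)) Qxq≈ε
        , trans (cancelᶜ xqQ≈ε P (x p)) Pxp≈ε ))

module MatrixMonoid {c ℓ : Level} (R : CommutativeRing c ℓ) where
  open CommutativeRing R hiding (zero)
  open Matrices R
  open SemiringSum semiring
    using (sum; sum-cong-≋; sum-replicate-zero; ∑-comm; *-distribˡ-sum; *-distribʳ-sum)
  open SetoidReasoning setoid

  ∑≡sum : ∀ {n} (f : Fin n → Carrier) → ∑ f ≡ sum f
  ∑≡sum {zero}  f = ≡-refl
  ∑≡sum {suc n} f = cong (f zero +_) (∑≡sum (f ∘ suc))

  ∑-cong : ∀ {n} {f g : Fin n → Carrier} → (∀ j → f j ≈ g j) → ∑ f ≈ ∑ g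
  ∑-cong {f = f} {g} f≈g = begin
    ∑ f    ≡⟨ ∑≡sum f ⟩
    sum f  ≈⟨ sum-cong-≋ f≈g ⟩
    sum g  ≡⟨ ∑≡sum g ⟨
    ∑ g    ∎

  ∑-vanishes : ∀ {n} {f : Fin n → Carrier} → (∀ j → f j ≈ 0#) → ∑ f ≈ 0#
  ∑-vanishes {n} f≈0 =
    trans (∑-cong f≈0) (trans (reflexive (∑≡sum {n} (λ _ → 0#))) (sum-replicate-zero n))

  ∑-swap : ∀ {m n} (f : Fin m → Fin n → Carrier) →
    ∑ (λ i → ∑ (λ j → f i j)) ≈ ∑ (λ j → ∑ (λ i → f i j))
  ∑-swap f = begin
    ∑ (λ i → ∑ (λ j → f i j))      ≈⟨ ∑-cong (λ i → reflexive (∑≡sum (f i))) ⟩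
    ∑ (λ i → sum (λ j → f i j))    ≡⟨ ∑≡sum (λ i → sum (f i)) ⟩
    sum (λ i → sum (λ j → f i j))  ≈⟨ ∑-comm f ⟩
    sum (λ j → sum (λ i → f i j))  ≡⟨ ∑≡sum (λ j → sum (λ i → f i j)) ⟨
    ∑ (λ j → sum (λ i → f i j))    ≈⟨ ∑-cong (λ j → reflexive (∑≡sum (λ i → f i j))) ⟨
    ∑ (λ j → ∑ (λ i → f i j))      ∎

  *-distribˡ-∑ : ∀ {n} x (f : Fin n → Carrier) → x * ∑ f ≈ ∑ (λ j → x * f j)
  *-distribˡ-∑ x f = begin
    x * ∑ f                ≡⟨ cong (x *_) (∑≡sum f) ⟩
    x * sum f              ≈⟨ *-distribˡ-sum x f ⟩
    sum (λ j → x * f j)    ≡⟨ ∑≡sum (λ j → x * f j) ⟨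
    ∑ (λ j → x * f j)      ∎

  *-distribʳ-∑ : ∀ {n} x (f : Fin n → Carrier) → ∑ f * x ≈ ∑ (λ j → f j * x)
  *-distribʳ-∑ x f = begin
    ∑ f * x                ≡⟨ cong (_* x) (∑≡sum f) ⟩
    sum f * x              ≈⟨ *-distribʳ-sum x f ⟩
    sum (λ j → f j * x)    ≡⟨ ∑≡sum (λ j → f j * x) ⟨
    ∑ (λ j → f j * x)      ∎

  ∑-Iˡ : ∀ {n} (v : Fin n → Carrier) i → ∑ (λ l → I i l * v l) ≈ v i
  ∑-Iˡ v zero    = trans (+-cong (*-identityˡ _) (∑-vanishes (λ l → zeroˡ (v (suc l))))) (+-identityʳ _)
  ∑-Iˡ v (suc i) = trans (+-cong (zeroˡ _) (∑-Iˡ (v ∘ suc) i)) (+-identityˡ _)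

  ∑-Iʳ : ∀ {n} (v : Fin n → Carrier) j → ∑ (λ l → v l * I l j) ≈ v j
  ∑-Iʳ v zero    = trans (+-cong (*-identityʳ _) (∑-vanishes (λ l → zeroʳ (v (suc l))))) (+-identityʳ _)
  ∑-Iʳ v (suc j) = trans (+-cong (zeroʳ _) (∑-Iʳ (v ∘ suc) j)) (+-identityˡ _)

  ⊗-assoc : ∀ {n} (A B C : Mat n) → (A ⊗ B) ⊗ C ≋ A ⊗ (B ⊗ C)
  ⊗-assoc A B C i j = begin
    ∑ (λ l → ∑ (λ p → A i p * B p l) * C l j)
      ≈⟨ ∑-cong (λ l → *-distribʳ-∑ (C l j) (λ p → A i p * B p l)) ⟩
    ∑ (λ l → ∑ (λ p → (A i p * B p l) * C l j))
      ≈⟨ ∑-swap (λ l p → (A i p * B p l) * C l j) ⟩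
    ∑ (λ p → ∑ (λ l → (A i p * B p l) * C l j))
      ≈⟨ ∑-cong (λ p → ∑-cong (λ l → *-assoc (A i p) (B p l) (C l j))) ⟩
    ∑ (λ p → ∑ (λ l → A i p * (B p l * C l j)))
      ≈⟨ ∑-cong (λ p → *-distribˡ-∑ (A i p) (λ l → B p l * C l j)) ⟨
    ∑ (λ p → A i p * ∑ (λ l → B p l * C l j))
      ∎

  ⊗-monoid : ℕ → Monoid c ℓ
  ⊗-monoid n = record
    { Carrier  = Mat n
    ; _≈_      = _≋_
    ; _∙_      = _⊗_
    ; ε        = I
    ; isMonoid = record
      { isSemigroup = record
        { isMagma = record
          { isEquivalence = record
            { refl  = λ i j → refl
            ; sym   = λ A≋B i j → sym (A≋B i j)
            ; trans = λ A≋B B≋C i j → trans (A≋B i j) (B≋C i j)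
            }
          ; ∙-cong = λ A≋A′ B≋B′ i j → ∑-cong (λ l → *-cong (A≋A′ i l) (B≋B′ l j))
          }
        ; assoc = ⊗-assoc
        }
      ; identity = (λ A i j → ∑-Iˡ (λ l → A l j) i) , (λ A i j → ∑-Iʳ (A i) j)
      }
    }

proposition2p4 : {c ℓ : Level} (R : CommutativeRing c ℓ) (n m : ℕ)
    → let open Matrices R in
    (A : Fin (suc m) → Mat n)
    → (ns₁ : Nonsingular (A zero))
    → (nsₖ : Nonsingular (A (fromℕ m)))
    → ((∀ (i j : Fin m) → Commute (proj₁ nsₖ ⊗ A (inject₁ i)) (proj₁ nsₖ ⊗ A (inject₁ j)))
    ⇔ (∀ (i j : Fin m) → Commute (proj₁ ns₁ ⊗ A (suc i)) (proj₁ ns₁ ⊗ A (suc j))))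
proposition2p4 R n m A (P , A₁P≈I , PA₁≈I) (Q , AₖQ≈I , QAₖ≈I) = mk⇔
  (λ comm i j → pairwiseCommuting-rebase A (A₁P≈I , PA₁≈I) (AₖQ≈I , QAₖ≈I)
                  (pairwiseCommuting-inject₁⁺ QAₖ≈I comm) (suc i) (suc j))
  (λ comm i j → pairwiseCommuting-rebase A (AₖQ≈I , QAₖ≈I) (A₁P≈I , PA₁≈I)
                  (pairwiseCommuting-suc⁺ PA₁≈I comm) (inject₁ i) (inject₁ j))
  where open CommutingFamilies (MatrixMonoid.⊗-monoid R n)
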